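{- Let $\phi(x)=2^{z_1}x+r_1$ with $z_1\in\mathbb Z$, $r_1\in\mathbb Q$. (1) Let $r\in\mathbb N$, $z\in\mathbb Z$, $B=M(2^r,z)$, and suppose $r+z_1\in\mathbb N$ and $2^{z_1}z+r_1\in\mathbb Z$, so that $B'=M(2^{r+z_1},2^{z_1}z+r_1)\in\mathcal B$. Then $\phi_{\mathcal M}(B)\sim B'$. (2) If $B\in\mathcal B$ and $\phi_{\mathcal M}(B)\setminus|\mathcal M|$ is finite, then $\phi_{\mathcal M}(B)\sim B'$ for some $B'\in\mathcal B$. (3) If $D\in\mathcal D$ and $\phi_{\mathcal M}(D)\subseteq|\mathcal M|$, then $\phi_{\mathcal M}(D)\in\mathcal D$.
   Context: $|\mathcal M|=\{(1,n)\mid n\in\mathbb N\}\cup\{(2,z)\mid z\in\mathbb Z\}\subseteq\mathbb Q+\mathbb Q:=\{(i,q)\mid i\in\{1,2\},q\in\mathbb Q\}$; write $(i,q)+m=(i,q+m)$, $0_{\mathcal M}=(1,0)$, $0_{\mathbb Z}=(2,0)$. For $\phi(x)=2^{z_1}x+r_1$, $\phi$ is even if $z_1$ is even and odd if $z_1$ is odd; $\phi_{\mathcal M}:\mathbb Q+\mathbb Q\to\mathbb Q+\mathbb Q$ is defined by $\phi_{\mathcal M}(i,q)=(i,\phi(q))$ if $\phi$ is even, and if $\phi$ is odd by $\phi_{\mathcal M}(1,q)=(2,\phi(q))$, $\phi_{\mathcal M}(2,q)=(2,\phi(q))$ for $q<0$, $\phi_{\mathcal M}(2,q)=(1,\phi(q))$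 for $q\ge0$; $\phi_{\mathcal M}(X)$ is the image of $X$. For sets, $I\sim J$ means $(I\setminus J)\cup(J\setminus I)$ is finite. For $r\in\mathbb N$, $s\in\mathbb Z$: $M(2^r,s)=\{0_{\mathcal M}+(2^rw+s)\mid w\in\mathbb Z,\ 2^rw+s\ge0\}\cup\{0_{\mathbb Z}+(2^rw+s)\mid w\in\mathbb Z\}$; $\mathcal B$ is the set of all such $M(2^r,s)$; $\mathcal D$ is the set of all $D\subseteq|\mathcal M|$ with $D\sim B_1\cup\dots\cup B_n$ for some $B_1,\dots,B_n\in\mathcal B$ ($n\ge0$). -}

module Defs where

open import Data.Nat as ℕ using (ℕ; zero; suc)
open import Data.Nat.Base using (_%_)
open import Data.Integer as ℤ using (ℤ; +_; -[1+_]; ∣_∣)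
open import Data.Rational as ℚ using (ℚ; _/_; ½)
open import Data.Product using (Σ; _×_; _,_; ∃)
open import Data.Sum using (_⊎_)
open import Data.List using (List)
open import Data.List.Membership.Propositional using (_∈_)
open import Data.List.Relation.Unary.Any using (Any)
open import Relation.Binary.PropositionalEquality using (_≡_)
open import Relation.Nullary using (¬_; yes; no)

-- the two summand tags of Q + Q
data Tag : Set where
  one two : Tag

QQ : Set
QQ = Tag × ℚ

Subset : Set₁
Subset = QQ → Set

ι : ℤ → ℚ
ι z = z / 1

pow2ℕ : ℕ → ℚ
pow2ℕ zero = ℚ.1ℚ
pow2ℕ (suc n) = ι (+ 2) ℚ.* pow2ℕ n

powHalf : ℕ → ℚ
powHalf zero = ℚ.1ℚ
powHalf (suc n) = ½ ℚ.* powHalf n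

pow2 : ℤ → ℚ
pow2 (+ n) = pow2ℕ n
pow2 -[1+ n ] = powHalf (suc n)

φ : ℤ → ℚ → ℚ → ℚ
φ z₁ r₁ x = pow2 z₁ ℚ.* x ℚ.+ r₁

φM-odd : ℤ → ℚ → QQ → QQ
φM-odd z₁ r₁ (one , q) = (two , φ z₁ r₁ q)
φM-odd z₁ r₁ (two , q) with q ℚ.<? ℚ.0ℚ
... | yes _ = (two , φ z₁ r₁ q)
... | no _  = (one , φ z₁ r₁ q)

φM : ℤ → ℚ → QQ → QQ
φM z₁ r₁ (i , q) with ∣ z₁ ∣ % 2  -- parity of z₁ (= parity of φ)
... | zero  = (i , φ z₁ r₁ q)
... | suc _ = φM-odd z₁ r₁ (i , q)

φM-img : ℤ → ℚ → Subset → Subset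
φM-img z₁ r₁ X y = Σ QQ λ x → X x × φM z₁ r₁ x ≡ y

InM : Subset
InM (one , q) = Σ ℕ λ n → q ≡ ι (+ n)
InM (two , q) = Σ ℤ λ z → q ≡ ι z

_∖_ : Subset → Subset → Subset
(X ∖ Y) x = X x × ¬ Y x

_∪_ : Subset → Subset → Subset
(X ∪ Y) x = X x ⊎ Y x

_⊆_ : Subset → Subset → Set
X ⊆ Y = ∀ x → X x → Y x

Finite : Subset → Set
Finite X = Σ (List QQ) λ xs → ∀ x → X x → x ∈ xs

_∼_ : Subset → Subset → Set
I ∼ J = Finite ((I ∖ J) ∪ (J ∖ I))

Mset : ℕ → ℤ → Subset
Mset r s (one , q) = Σ ℤ λ w → (+ 0 ℤ.≤ (+ (2 ℕ.^ r) ℤ.* w ℤ.+ s)) × q ≡ ι (+ (2 ℕ.^ r) ℤ.* w ℤ.+ s)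
Mset r s (two , q) = Σ ℤ λ w → q ≡ ι (+ (2 ℕ.^ r) ℤ.* w ℤ.+ s)

Inℬ : Subset → Set
Inℬ B = Σ ℕ λ r → Σ ℤ λ s → ∀ x → (B x → Mset r s x) × (Mset r s x → B x)

⋃M : List (ℕ × ℤ) → Subset
⋃M bs x = Any (λ p → Mset (Data.Product.proj₁ p) (Data.Product.proj₂ p) x) bs

Inᴰ : Subset → Set
Inᴰ D = D ⊆ InM × Σ (List (ℕ × ℤ)) λ bs → D ∼ ⋃M bs

-- On M(2^r,s) the map φ_M preserves the shape {(2,v w) | w ∈ ℤ} ∪ {(1,v w) | 2^r w + s ≥ 0},
-- with v w = φ(2^r w + s) = 2^(r+z₁) w + φ(s): for odd φ the tags are swapped exactly on the
-- nonnegative terms. If r + z₁ ≥ 0 and φ(s) ∈ ℤ, this set differs from M(2^(r+z₁), φ(s)) only at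
-- the w where 2^r w + s and 2^(r+z₁) w + φ(s) have opposite signs, and such w are bounded. Otherwise
-- infinitely many v w are not integers, so φ_M(B) ∖ |M| is infinite. For (3), φ_M commutes with
-- finite unions and maps ∼-equivalent sets to ∼-equivalent sets.
module Submission where

open import Defs
open import Data.Nat as ℕ using (ℕ; zero; suc)
import Data.Nat.Properties as ℕP
open import Data.Integer as ℤ using (ℤ; +_; -[1+_]; ∣_∣)
import Data.Integer.Properties as ℤP
open import Data.Rational as ℚ using (ℚ; mkℚ; ½)
import Data.Rational.Properties as ℚP
open import Data.Rational.Solver using (module +-*-Solver)
open import Algebra.Properties.Group ℚP.+-0-group using (∙-cancelʳ)
import Data.Nat.Coprimality as Coprimality
import Data.Fin as Fin
import Data.Fin.Properties as FinP
open import Data.List as List using (List; []; _∷_; _++_)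
open import Data.List.Membership.Propositional using (_∈_)
open import Data.List.Membership.Propositional.Properties using (∈-map⁺; ∈-++⁺ˡ; ∈-++⁺ʳ)
open import Data.List.Relation.Unary.Any as Any using (here; there)
import Data.List.Relation.Unary.Any.Properties as AnyP
open import Data.List.Relation.Unary.All as All using (All; []; _∷_)
open import Data.Product using (Σ; _×_; _,_; proj₁; proj₂; map₂)
open import Data.Product.Properties using (≡-dec)
open import Data.Sum using (inj₁; inj₂)
open import Data.Empty using (⊥-elim)
open import Function using (_∘_; _⇔_; mk⇔; Equivalence)
open import Relation.Nullary using (¬_; yes; no; Dec)
open import Relation.Binary.Definitions using (DecidableEquality)
open import Relation.Binary.PropositionalEquality

ι-mkℚ : ∀ z → ι z ≡ mkℚ z 0 (Coprimality.sym (Coprimality.1-coprimeTo ∣ z ∣))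
ι-mkℚ (+ n) = ℚP.normalize-coprime (Coprimality.sym (Coprimality.1-coprimeTo n))
ι-mkℚ -[1+ n ] = cong ℚ.-_ (ℚP.normalize-coprime (Coprimality.sym (Coprimality.1-coprimeTo (suc n))))

ι-+ : ∀ a b → ι (a ℤ.+ b) ≡ ι a ℚ.+ ι b
ι-+ a b rewrite ι-mkℚ a | ι-mkℚ b = cong ι (cong₂ ℤ._+_ (sym (ℤP.*-identityʳ a)) (sym (ℤP.*-identityʳ b)))

ι-* : ∀ a b → ι (a ℤ.* b) ≡ ι a ℚ.* ι b
ι-* a b rewrite ι-mkℚ a | ι-mkℚ b = refl

ι-neg : ∀ a → ι (ℤ.- a) ≡ ℚ.- ι a
ι-neg a rewrite ι-mkℚ a | ι-mkℚ (ℤ.- a) with a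
... | + zero = refl
... | + suc n = refl
... | -[1+ n ] = refl

ι-injective : ∀ {a b} → ι a ≡ ι b → a ≡ b
ι-injective {a} {b} e rewrite ι-mkℚ a | ι-mkℚ b = cong ℚ.numerator e

ι<0⇒<0 : ∀ a → ι a ℚ.< ℚ.0ℚ → a ℤ.< + 0
ι<0⇒<0 a h with ℚP.drop-*<* h
... | d rewrite ι-mkℚ a = subst (ℤ._< + 0) (ℤP.*-identityʳ a) d

<0⇒ι<0 : ∀ a → a ℤ.< + 0 → ι a ℚ.< ℚ.0ℚ
<0⇒ι<0 a h rewrite ι-mkℚ a = ℚ.*<* (subst (ℤ._< + 0) (sym (ℤP.*-identityʳ a)) h)

0≤⇔¬ι<0 : ∀ a → (+ 0 ℤ.≤ a) ⇔ (¬ ι a ℚ.< ℚ.0ℚ)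
0≤⇔¬ι<0 a = mk⇔ (λ 0≤a ι<0 → ℤP.<⇒≱ (ι<0⇒<0 a ι<0) 0≤a) (λ ¬ι<0 → ℤP.≮⇒≥ (¬ι<0 ∘ <0⇒ι<0 a))

ι-2^ : ∀ n → ι (+ (2 ℕ.^ n)) ≡ pow2ℕ n
ι-2^ zero = refl
ι-2^ (suc n) = begin
  ι (+ (2 ℕ.* 2 ℕ.^ n))        ≡⟨ cong ι (ℤP.pos-* 2 (2 ℕ.^ n)) ⟩
  ι (+ 2 ℤ.* + (2 ℕ.^ n))      ≡⟨ ι-* (+ 2) (+ (2 ℕ.^ n)) ⟩
  ι (+ 2) ℚ.* ι (+ (2 ℕ.^ n))  ≡⟨ cong (ι (+ 2) ℚ.*_) (ι-2^ n) ⟩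
  ι (+ 2) ℚ.* pow2ℕ n          ∎
  where open ≡-Reasoning

pow2-suc : ∀ z → pow2 (ℤ.suc z) ≡ ι (+ 2) ℚ.* pow2 z
pow2-suc (+ n) = refl
pow2-suc -[1+ zero ] = refl
pow2-suc -[1+ suc n ] = begin
  powHalf (suc n)                            ≡⟨ ℚP.*-identityˡ (powHalf (suc n)) ⟨
  (ι (+ 2) ℚ.* ½) ℚ.* powHalf (suc n)        ≡⟨ ℚP.*-assoc (ι (+ 2)) ½ (powHalf (suc n)) ⟩
  ι (+ 2) ℚ.* (½ ℚ.* powHalf (suc n))        ∎
  where open ≡-Reasoning

pow2-+ : ∀ r z → pow2 (+ r ℤ.+ z) ≡ pow2ℕ r ℚ.* pow2 z
pow2-+ zero z = trans (cong pow2 (ℤP.+-identityˡ z)) (sym (ℚP.*-identityˡ (pow2 z)))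
pow2-+ (suc r) z = begin
  pow2 (+ suc r ℤ.+ z)                   ≡⟨ cong pow2 (ℤP.suc-+ r z) ⟩
  pow2 (ℤ.suc (+ r ℤ.+ z))               ≡⟨ pow2-suc (+ r ℤ.+ z) ⟩
  ι (+ 2) ℚ.* pow2 (+ r ℤ.+ z)           ≡⟨ cong (ι (+ 2) ℚ.*_) (pow2-+ r z) ⟩
  ι (+ 2) ℚ.* (pow2ℕ r ℚ.* pow2 z)       ≡⟨ ℚP.*-assoc (ι (+ 2)) (pow2ℕ r) (pow2 z) ⟨
  pow2ℕ (suc r) ℚ.* pow2 z               ∎
  where open ≡-Reasoning

pow2ℕ*powHalf : ∀ n → pow2ℕ n ℚ.* powHalf n ≡ ℚ.1ℚ
pow2ℕ*powHalf n = begin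
  pow2ℕ n ℚ.* powHalf n               ≡⟨ cong (pow2ℕ n ℚ.*_) (pow2-neg n) ⟨
  pow2ℕ n ℚ.* pow2 (ℤ.- + n)          ≡⟨ pow2-+ n (ℤ.- + n) ⟨
  pow2 (+ n ℤ.+ ℤ.- + n)              ≡⟨ cong pow2 (ℤP.+-inverseʳ (+ n)) ⟩
  ℚ.1ℚ                                ∎
  where
  open ≡-Reasoning
  pow2-neg : ∀ n → pow2 (ℤ.- + n) ≡ powHalf n
  pow2-neg zero = refl
  pow2-neg (suc n) = refl

IsInt : ℚ → Set
IsInt q = Σ ℤ λ z → q ≡ ι z

¬IsInt-if-denominator≢1 : ∀ q → ℚ.denominator-1 q ≢ 0 → ¬ IsInt q
¬IsInt-if-denominator≢1 q den≢1 (z , refl) = den≢1 (cong ℚ.denominator-1 (ι-mkℚ z))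

isInt? : ∀ q → Dec (IsInt q)
isInt? (mkℚ n zero _) = yes (n , sym (ι-mkℚ n))
isInt? q@(mkℚ n (suc d) _) = no (¬IsInt-if-denominator≢1 q ℕP.1+n≢0)

¬IsInt-½ : ¬ IsInt ½
¬IsInt-½ = ¬IsInt-if-denominator≢1 ½ ℕP.1+n≢0

IsInt-cancelˡ : ∀ g d → IsInt (ι g ℚ.+ d) → IsInt d
IsInt-cancelˡ g d (z , e) = z ℤ.+ ℤ.- g , (begin
  d                               ≡⟨ solve 2 (λ a d → d := (a :+ d) :+ (:- a)) refl (ι g) d ⟩
  (ι g ℚ.+ d) ℚ.+ ℚ.- ι g         ≡⟨ cong₂ ℚ._+_ e (sym (ι-neg g)) ⟩
  ι z ℚ.+ ι (ℤ.- g)               ≡⟨ ι-+ z (ℤ.- g) ⟨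
  ι (z ℤ.+ ℤ.- g)                 ∎)
  where
  open ≡-Reasoning
  open +-*-Solver

absRange : ℕ → List ℤ
absRange zero = + 0 ∷ []
absRange (suc n) = + suc n ∷ -[1+ n ] ∷ absRange n

∈-absRange : ∀ N w → ∣ w ∣ ℕ.≤ N → w ∈ absRange N
∈-absRange zero (+ zero) _ = here refl
∈-absRange (suc N) w h with ℕP.m≤n⇒m<n∨m≡n h
... | inj₁ lt = there (there (∈-absRange N w (ℕP.≤-pred lt)))
∈-absRange (suc N) (+ n) h | inj₂ e = here (cong +_ e)
∈-absRange (suc N) -[1+ n ] h | inj₂ e = there (here (cong -[1+_] (ℕP.suc-injective e)))

nonNeg-root-bound : ∀ a .{{_ : ℕ.NonZero a}} n z → + a ℤ.* + n ℤ.+ z ℤ.≤ + 0 → n ℕ.≤ ∣ z ∣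
nonNeg-root-bound a n z h = ℤP.drop‿+≤+ (begin
  + n           ≤⟨ n≤-z ⟩
  ℤ.- z         ≡⟨ ℤP.0≤i⇒+∣i∣≡i (ℤP.≤-trans (ℤ.+≤+ ℕ.z≤n) n≤-z) ⟨
  + ∣ ℤ.- z ∣   ≡⟨ cong +_ (ℤP.∣-i∣≡∣i∣ z) ⟩
  + ∣ z ∣       ∎)
  where
  open ℤP.≤-Reasoning
  n≤-z : + n ℤ.≤ ℤ.- z
  n≤-z = begin
    + n             ≤⟨ ℤ.+≤+ (ℕP.m≤n*m n a) ⟩
    + (a ℕ.* n)     ≡⟨ ℤP.pos-* a n ⟩
    + a ℤ.* + n     ≤⟨ ℤP.i-j≤0⇒i≤j (subst (λ t → + a ℤ.* + n ℤ.+ t ℤ.≤ + 0) (sym (ℤP.neg-involutive z)) h) ⟩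
    ℤ.- z           ∎

sign-change-bound : ∀ a b .{{_ : ℕ.NonZero a}} .{{_ : ℕ.NonZero b}} w z s
  → + 0 ℤ.≤ + a ℤ.* w ℤ.+ z → ¬ (+ 0 ℤ.≤ + b ℤ.* w ℤ.+ s) → ∣ w ∣ ℕ.≤ ∣ z ∣ ℕ.+ ∣ s ∣
sign-change-bound a b (+ n) z s _ h = ℕP.≤-trans
  (nonNeg-root-bound b n s (ℤP.<⇒≤ (ℤP.≰⇒> h))) (ℕP.m≤n+m ∣ s ∣ ∣ z ∣)
sign-change-bound a b w@(-[1+ n ]) z s h _ = ℕP.≤-trans
  (subst (suc n ℕ.≤_) (ℤP.∣-i∣≡∣i∣ z) (nonNeg-root-bound a (suc n) (ℤ.- z) negated)) (ℕP.m≤m+n ∣ z ∣ ∣ s ∣)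
  where
  negated : + a ℤ.* + suc n ℤ.+ ℤ.- z ℤ.≤ + 0
  negated = subst (ℤ._≤ + 0)
    (trans (ℤP.neg-distrib-+ (+ a ℤ.* w) z) (cong (ℤ._+ ℤ.- z) (ℤP.neg-distribʳ-* (+ a) w)))
    (ℤP.neg-mono-≤ h)

infix 4 _≐_
_≐_ : Subset → Subset → Set
X ≐ Y = X ⊆ Y × Y ⊆ X

≐-refl : ∀ {X} → X ≐ X
≐-refl = (λ _ h → h) , (λ _ h → h)

≐-sym : ∀ {X Y} → X ≐ Y → Y ≐ X
≐-sym (X⊆Y , Y⊆X) = Y⊆X , X⊆Y

≐-trans : ∀ {X Y Z} → X ≐ Y → Y ≐ Z → X ≐ Z
≐-trans (X⊆Y , Y⊆X) (Y⊆Z , Z⊆Y) = (λ x → Y⊆Z x ∘ X⊆Y x) , (λ x → Y⊆X x ∘ Z⊆Y x)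

Finite-⊆ : ∀ {X Y} → X ⊆ Y → Finite Y → Finite X
Finite-⊆ X⊆Y (xs , cover) = xs , λ x → cover x ∘ X⊆Y x

∼-resp-≐ : ∀ {X X' Y Y'} → X ≐ X' → Y ≐ Y' → X ∼ Y → X' ∼ Y'
∼-resp-≐ (X⊆X' , X'⊆X) (Y⊆Y' , Y'⊆Y) (xs , cover) = xs , λ where
  x (inj₁ (X'x , ¬Y'x)) → cover x (inj₁ (X'⊆X x X'x , ¬Y'x ∘ Y⊆Y' x))
  x (inj₂ (Y'x , ¬X'x)) → cover x (inj₂ (Y'⊆Y x Y'x , ¬X'x ∘ X⊆X' x))

∼-∪ : ∀ {X X' Y Y'} → X ∼ Y → X' ∼ Y' → (X ∪ X') ∼ (Y ∪ Y')
∼-∪ (xs , cover) (xs' , cover') = xs ++ xs' , λ where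
  x (inj₁ (inj₁ Xx , ¬Yx)) → ∈-++⁺ˡ (cover x (inj₁ (Xx , ¬Yx ∘ inj₁)))
  x (inj₁ (inj₂ X'x , ¬Yx)) → ∈-++⁺ʳ xs (cover' x (inj₁ (X'x , ¬Yx ∘ inj₂)))
  x (inj₂ (inj₁ Yx , ¬Xx)) → ∈-++⁺ˡ (cover x (inj₂ (Yx , ¬Xx ∘ inj₁)))
  x (inj₂ (inj₂ Y'x , ¬Xx)) → ∈-++⁺ʳ xs (cover' x (inj₂ (Y'x , ¬Xx ∘ inj₂)))

_≟Tag_ : DecidableEquality Tag
one ≟Tag one = yes refl
one ≟Tag two = no λ ()
two ≟Tag one = no λ ()
two ≟Tag two = yes refl

open import Data.List.Membership.DecPropositional (≡-dec _≟Tag_ ℚP._≟_) using (_∈?_)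

-- Constructive because membership in the covering list is decidable.
∼-trans : ∀ {X Y Z} → X ∼ Y → Y ∼ Z → X ∼ Z
∼-trans {X} {Y} {Z} (xs , coverXY) (ys , coverYZ) = xs ++ ys , cover
  where
  cover : ∀ x → ((X ∖ Z) ∪ (Z ∖ X)) x → x ∈ xs ++ ys
  cover x _ with x ∈? xs ++ ys
  ... | yes x∈ = x∈
  cover x (inj₁ (Xx , ¬Zx)) | no x∉ =
    ⊥-elim (x∉ (∈-++⁺ˡ (coverXY x (inj₁ (Xx , λ Yx → x∉ (∈-++⁺ʳ xs (coverYZ x (inj₁ (Yx , ¬Zx)))))))))
  cover x (inj₂ (Zx , ¬Xx)) | no x∉ =
    ⊥-elim (x∉ (∈-++⁺ʳ xs (coverYZ x (inj₂ (Zx , λ Yx → x∉ (∈-++⁺ˡ (coverXY x (inj₂ (Yx , ¬Xx)))))))))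

injection-⊈-list : ∀ {A : Set} (xs : List A) (f : ℕ → A) → (∀ {m n} → f m ≡ f n → m ≡ n) → ¬ (∀ n → f n ∈ xs)
injection-⊈-list xs f f-injective f∈xs
  with FinP.pigeonhole (ℕP.n<1+n (List.length xs)) (Any.index ∘ f∈xs ∘ Fin.toℕ)
... | i , j , i<j , same-index = ℕP.<-irrefl (f-injective (begin
  f (Fin.toℕ i)                                   ≡⟨ AnyP.lookup-index (f∈xs (Fin.toℕ i)) ⟩
  List.lookup xs (Any.index (f∈xs (Fin.toℕ i)))   ≡⟨ cong (List.lookup xs) same-index ⟩
  List.lookup xs (Any.index (f∈xs (Fin.toℕ j)))   ≡⟨ AnyP.lookup-index (f∈xs (Fin.toℕ j)) ⟨
  f (Fin.toℕ j)                                   ∎)) i<j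
  where open ≡-Reasoning

finite⇒¬injection : ∀ {X} → Finite X → (f : ℕ → QQ) → (∀ {m n} → f m ≡ f n → m ≡ n) → ¬ (∀ n → X (f n))
finite⇒¬injection (xs , cover) f f-injective X∋f = injection-⊈-list xs f f-injective (λ n → cover (f n) (X∋f n))

prog : ℕ → ℤ → ℤ → ℤ
prog r s w = + (2 ℕ.^ r) ℤ.* w ℤ.+ s

ι-prog : ∀ r s w → ι (prog r s w) ≡ pow2ℕ r ℚ.* ι w ℚ.+ ι s
ι-prog r s w = begin
  ι (+ (2 ℕ.^ r) ℤ.* w ℤ.+ s)           ≡⟨ ι-+ (+ (2 ℕ.^ r) ℤ.* w) s ⟩
  ι (+ (2 ℕ.^ r) ℤ.* w) ℚ.+ ι s         ≡⟨ cong (ℚ._+ ι s) (ι-* (+ (2 ℕ.^ r)) w) ⟩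
  ι (+ (2 ℕ.^ r)) ℚ.* ι w ℚ.+ ι s       ≡⟨ cong (λ a → a ℚ.* ι w ℚ.+ ι s) (ι-2^ r) ⟩
  pow2ℕ r ℚ.* ι w ℚ.+ ι s               ∎
  where open ≡-Reasoning

powHalf-prog : ∀ m e w → powHalf m ℚ.* ι (prog m e w) ≡ ι w ℚ.+ powHalf m ℚ.* ι e
powHalf-prog m e w = begin
  powHalf m ℚ.* ι (prog m e w)                         ≡⟨ cong (powHalf m ℚ.*_) (ι-prog m e w) ⟩
  powHalf m ℚ.* (pow2ℕ m ℚ.* ι w ℚ.+ ι e)              ≡⟨ solve 4 (λ h p x y → h :* (p :* x :+ y) := (p :* h) :* x :+ h :* y)
                                                            refl (powHalf m) (pow2ℕ m) (ι w) (ι e) ⟩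
  (pow2ℕ m ℚ.* powHalf m) ℚ.* ι w ℚ.+ powHalf m ℚ.* ι e ≡⟨ cong (λ a → a ℚ.* ι w ℚ.+ powHalf m ℚ.* ι e) (pow2ℕ*powHalf m) ⟩
  ℚ.1ℚ ℚ.* ι w ℚ.+ powHalf m ℚ.* ι e                   ≡⟨ cong (ℚ._+ powHalf m ℚ.* ι e) (ℚP.*-identityˡ (ι w)) ⟩
  ι w ℚ.+ powHalf m ℚ.* ι e                            ∎
  where
  open ≡-Reasoning
  open +-*-Solver

-- c and c + ½ cannot both be integers, and 2^k is the numerator of ½ over 2^(k+1).
∃-nonIntegral-offset : ∀ k c → Σ ℤ λ e → ¬ IsInt (powHalf (suc k) ℚ.* ι e ℚ.+ c)
∃-nonIntegral-offset k c with isInt? c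
... | no c∉ℤ = + 0 , subst (¬_ ∘ IsInt) (sym zero-offset) c∉ℤ
  where
  zero-offset : powHalf (suc k) ℚ.* ι (+ 0) ℚ.+ c ≡ c
  zero-offset = trans (cong (ℚ._+ c) (ℚP.*-zeroʳ (powHalf (suc k)))) (ℚP.+-identityˡ c)
... | yes (y , refl) = + (2 ℕ.^ k) , λ int → ¬IsInt-½ (IsInt-cancelˡ y ½ (subst IsInt half-offset int))
  where
  open ≡-Reasoning
  half-offset : powHalf (suc k) ℚ.* ι (+ (2 ℕ.^ k)) ℚ.+ ι y ≡ ι y ℚ.+ ½
  half-offset = begin
    (½ ℚ.* powHalf k) ℚ.* ι (+ (2 ℕ.^ k)) ℚ.+ ι y    ≡⟨ cong (λ t → (½ ℚ.* powHalf k) ℚ.* t ℚ.+ ι y) (ι-2^ k) ⟩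
    (½ ℚ.* powHalf k) ℚ.* pow2ℕ k ℚ.+ ι y            ≡⟨ cong (ℚ._+ ι y) (ℚP.*-assoc ½ (powHalf k) (pow2ℕ k)) ⟩
    ½ ℚ.* (powHalf k ℚ.* pow2ℕ k) ℚ.+ ι y            ≡⟨ cong (λ t → ½ ℚ.* t ℚ.+ ι y) (trans (ℚP.*-comm (powHalf k) (pow2ℕ k)) (pow2ℕ*powHalf k)) ⟩
    ½ ℚ.* ℚ.1ℚ ℚ.+ ι y                               ≡⟨ ℚP.+-comm (½ ℚ.* ℚ.1ℚ) (ι y) ⟩
    ι y ℚ.+ ½                                        ∎

-- The common shape of M(2^r,s) and of its image under φ_M.
Fibres : (ℤ → ℚ) → (ℤ → Set) → Subset
Fibres v c (one , q) = Σ ℤ λ w → c w × q ≡ v w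
Fibres v c (two , q) = Σ ℤ λ w → q ≡ v w

NonNegAt : ℕ → ℤ → ℤ → Set
NonNegAt r s w = + 0 ℤ.≤ prog r s w

Mset≐Fibres : ∀ r s → Mset r s ≐ Fibres (ι ∘ prog r s) (NonNegAt r s)
Mset≐Fibres r s = (λ { (one , q) h → h ; (two , q) h → h }) , (λ { (one , q) h → h ; (two , q) h → h })

Fibres-∼ : ∀ v {c c'} (ws : List ℤ)
  → (∀ w → c w → ¬ c' w → w ∈ ws) → (∀ w → c' w → ¬ c w → w ∈ ws)
  → Fibres v c ∼ Fibres v c'
Fibres-∼ v ws c∖c'⊆ws c'∖c⊆ws = List.map (λ w → one , v w) ws , λ where
  (one , q) (inj₁ ((w , cw , refl) , ∉c')) → ∈-map⁺ _ (c∖c'⊆ws w cw (λ c'w → ∉c' (w , c'w , refl)))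
  (one , q) (inj₂ ((w , c'w , refl) , ∉c)) → ∈-map⁺ _ (c'∖c⊆ws w c'w (λ cw → ∉c (w , cw , refl)))
  (two , q) (inj₁ ((w , refl) , ∉c')) → ⊥-elim (∉c' (w , refl))
  (two , q) (inj₂ ((w , refl) , ∉c)) → ⊥-elim (∉c (w , refl))

Fibres-NonNegAt-∼ : ∀ v r z r' s → Fibres v (NonNegAt r z) ∼ Fibres v (NonNegAt r' s)
Fibres-NonNegAt-∼ v r z r' s = Fibres-∼ v (absRange (∣ z ∣ ℕ.+ ∣ s ∣))
  (λ w 0≤u ¬0≤u' → ∈-absRange _ w
    (sign-change-bound (2 ℕ.^ r) (2 ℕ.^ r') {{ℕP.m^n≢0 2 r}} {{ℕP.m^n≢0 2 r'}} w z s 0≤u ¬0≤u'))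
  (λ w 0≤u' ¬0≤u → ∈-absRange _ w (subst (∣ w ∣ ℕ.≤_) (ℕP.+-comm ∣ s ∣ ∣ z ∣)
    (sign-change-bound (2 ℕ.^ r') (2 ℕ.^ r) {{ℕP.m^n≢0 2 r'}} {{ℕP.m^n≢0 2 r}} w s z 0≤u' ¬0≤u)))

⋃M-∷ : ∀ b bs → ⋃M (b ∷ bs) ≐ Mset (proj₁ b) (proj₂ b) ∪ ⋃M bs
⋃M-∷ b bs = (λ { x (here h) → inj₁ h ; x (there h) → inj₂ h }) , (λ { x (inj₁ h) → here h ; x (inj₂ h) → there h })

Mset⊆⋃M : ∀ {b bs} → b ∈ bs → Mset (proj₁ b) (proj₂ b) ⊆ ⋃M bs
Mset⊆⋃M b∈bs x h = Any.map (λ { refl → h }) b∈bs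

module _ (z₁ : ℤ) (r₁ : ℚ) where

  img : Subset → Subset
  img = φM-img z₁ r₁

  data Parity : Set where
    even : (∀ i q → φM z₁ r₁ (i , q) ≡ (i , φ z₁ r₁ q)) → Parity
    odd  : (∀ x → φM z₁ r₁ x ≡ φM-odd z₁ r₁ x) → Parity

  parity : Parity
  parity with ∣ z₁ ∣ ℕ.% 2 in eq
  ... | zero = even by-even
    where
    by-even : ∀ i q → φM z₁ r₁ (i , q) ≡ (i , φ z₁ r₁ q)
    by-even i q rewrite eq = refl
  ... | suc _ = odd by-odd
    where
    by-odd : ∀ x → φM z₁ r₁ x ≡ φM-odd z₁ r₁ x
    by-odd (i , q) rewrite eq = refl

  φM-odd-neg : ∀ q → q ℚ.< ℚ.0ℚ → φM-odd z₁ r₁ (two , q) ≡ (two , φ z₁ r₁ q)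
  φM-odd-neg q q<0 with q ℚ.<? ℚ.0ℚ
  ... | yes _ = refl
  ... | no q≮0 = ⊥-elim (q≮0 q<0)

  φM-odd-nonNeg : ∀ q → ¬ q ℚ.< ℚ.0ℚ → φM-odd z₁ r₁ (two , q) ≡ (one , φ z₁ r₁ q)
  φM-odd-nonNeg q q≮0 with q ℚ.<? ℚ.0ℚ
  ... | yes q<0 = ⊥-elim (q≮0 q<0)
  ... | no _ = refl

  img-⊆ : ∀ {X Y} → X ⊆ Y → img X ⊆ img Y
  img-⊆ X⊆Y y (x , Xx , refl) = x , X⊆Y x Xx , refl

  img-≐ : ∀ {X Y} → X ≐ Y → img X ≐ img Y
  img-≐ (X⊆Y , Y⊆X) = img-⊆ X⊆Y , img-⊆ Y⊆X

  img-∪ : ∀ {X Y} → img (X ∪ Y) ≐ img X ∪ img Y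
  img-∪ = (λ { y (x , inj₁ Xx , refl) → inj₁ (x , Xx , refl) ; y (x , inj₂ Yx , refl) → inj₂ (x , Yx , refl) })
        , (λ { y (inj₁ (x , Xx , refl)) → x , inj₁ Xx , refl ; y (inj₂ (x , Yx , refl)) → x , inj₂ Yx , refl })

  img-∼ : ∀ {X Y} → X ∼ Y → img X ∼ img Y
  img-∼ (xs , cover) = List.map (φM z₁ r₁) xs , λ where
    y (inj₁ ((x , Xx , refl) , ∉imgY)) → ∈-map⁺ _ (cover x (inj₁ (Xx , λ Yx → ∉imgY (x , Yx , refl))))
    y (inj₂ ((x , Yx , refl) , ∉imgX)) → ∈-map⁺ _ (cover x (inj₂ (Yx , λ Xx → ∉imgX (x , Xx , refl))))

  img-Fibres : ∀ v v' c → (∀ w → φ z₁ r₁ (v w) ≡ v' w) → (∀ w → c w ⇔ (¬ v w ℚ.< ℚ.0ℚ))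
    → img (Fibres v c) ≐ Fibres v' c
  img-Fibres v v' c φv≡v' c⇔ = into , onto
    where
    open Equivalence
    into : img (Fibres v c) ⊆ Fibres v' c
    into _ ((one , _) , (w , cw , refl) , refl) with parity
    ... | even ev rewrite ev one (v w) = w , cw , φv≡v' w
    ... | odd od rewrite od (one , v w) = w , φv≡v' w
    into _ ((two , _) , (w , refl) , refl) with parity
    ... | even ev rewrite ev two (v w) = w , φv≡v' w
    ... | odd od rewrite od (two , v w) with v w ℚ.<? ℚ.0ℚ
    ...   | yes _ = w , φv≡v' w
    ...   | no v≮0 = w , from (c⇔ w) v≮0 , φv≡v' w
    onto : Fibres v' c ⊆ img (Fibres v c)
    onto (one , _) (w , cw , refl) with parity
    ... | even ev = (one , v w) , (w , cw , refl) , trans (ev one (v w)) (cong (one ,_) (φv≡v' w))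
    ... | odd od = (two , v w) , (w , refl)
                 , trans (od _) (trans (φM-odd-nonNeg (v w) (to (c⇔ w) cw)) (cong (one ,_) (φv≡v' w)))
    onto (two , _) (w , refl) with parity
    ... | even ev = (two , v w) , (w , refl) , trans (ev two (v w)) (cong (two ,_) (φv≡v' w))
    ... | odd od with v w ℚ.<? ℚ.0ℚ
    ...   | yes v<0 = (two , v w) , (w , refl) , trans (od _) (trans (φM-odd-neg (v w) v<0) (cong (two ,_) (φv≡v' w)))
    ...   | no v≮0 = (one , v w) , (w , from (c⇔ w) v≮0 , refl) , trans (od _) (cong (two ,_) (φv≡v' w))

  img-Mset : ∀ r s v' → (∀ w → φ z₁ r₁ (ι (prog r s w)) ≡ v' w) → img (Mset r s) ≐ Fibres v' (NonNegAt r s)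
  img-Mset r s v' φ≡v' =
    ≐-trans (img-≐ (Mset≐Fibres r s)) (img-Fibres (ι ∘ prog r s) v' (NonNegAt r s) φ≡v' (0≤⇔¬ι<0 ∘ prog r s))

  φ-prog : ∀ r s w → φ z₁ r₁ (ι (prog r s w)) ≡ pow2 (+ r ℤ.+ z₁) ℚ.* ι w ℚ.+ φ z₁ r₁ (ι s)
  φ-prog r s w = begin
    pow2 z₁ ℚ.* ι (prog r s w) ℚ.+ r₁                         ≡⟨ cong (λ q → pow2 z₁ ℚ.* q ℚ.+ r₁) (ι-prog r s w) ⟩
    pow2 z₁ ℚ.* (pow2ℕ r ℚ.* ι w ℚ.+ ι s) ℚ.+ r₁              ≡⟨ solve 5 (λ a p x y b → a :* (p :* x :+ y) :+ b := (a :* p) :* x :+ (a :* y :+ b))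
                                                                   refl (pow2 z₁) (pow2ℕ r) (ι w) (ι s) r₁ ⟩
    (pow2 z₁ ℚ.* pow2ℕ r) ℚ.* ι w ℚ.+ φ z₁ r₁ (ι s)           ≡⟨ cong (λ p → p ℚ.* ι w ℚ.+ φ z₁ r₁ (ι s)) slope ⟩
    pow2 (+ r ℤ.+ z₁) ℚ.* ι w ℚ.+ φ z₁ r₁ (ι s)               ∎
    where
    open ≡-Reasoning
    open +-*-Solver
    slope : pow2 z₁ ℚ.* pow2ℕ r ≡ pow2 (+ r ℤ.+ z₁)
    slope = trans (ℚP.*-comm (pow2 z₁) (pow2ℕ r)) (sym (pow2-+ r z₁))

  img-Mset-∼ : ∀ r z r' s' → + r' ≡ + r ℤ.+ z₁ → ι s' ≡ φ z₁ r₁ (ι z) → img (Mset r z) ∼ Mset r' s'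
  img-Mset-∼ r z r' s' r'≡r+z₁ s'≡φz = ∼-resp-≐
    (≐-sym (img-Mset r z (ι ∘ prog r' s') φ-on-terms)) (≐-sym (Mset≐Fibres r' s'))
    (Fibres-NonNegAt-∼ (ι ∘ prog r' s') r z r' s')
    where
    φ-on-terms : ∀ w → φ z₁ r₁ (ι (prog r z w)) ≡ ι (prog r' s' w)
    φ-on-terms w = begin
      φ z₁ r₁ (ι (prog r z w))                        ≡⟨ φ-prog r z w ⟩
      pow2 (+ r ℤ.+ z₁) ℚ.* ι w ℚ.+ φ z₁ r₁ (ι z)     ≡⟨ cong₂ (λ p c → p ℚ.* ι w ℚ.+ c) (cong pow2 (sym r'≡r+z₁)) (sym s'≡φz) ⟩
      pow2ℕ r' ℚ.* ι w ℚ.+ ι s'                       ≡⟨ ι-prog r' s' w ⟨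
      ι (prog r' s' w)                                ∎
      where open ≡-Reasoning

  img-Mset-nonIntegral : ∀ r s (G : ℕ → ℤ) → (∀ {m n} → G m ≡ G n → m ≡ n) → ∀ d → ¬ IsInt d
    → (W : ℕ → ℤ) → (∀ n → φ z₁ r₁ (ι (prog r s (W n))) ≡ ι (G n) ℚ.+ d)
    → ¬ Finite (img (Mset r s) ∖ InM)
  img-Mset-nonIntegral r s G G-injective d d∉ℤ W φ∘W≡ fin = finite⇒¬injection fin point point-injective point∈
    where
    point : ℕ → QQ
    point n = two , ι (G n) ℚ.+ d
    point-injective : ∀ {m n} → point m ≡ point n → m ≡ n
    point-injective {m} {n} e = G-injective (ι-injective (∙-cancelʳ d (ι (G m)) (ι (G n)) (cong proj₂ e)))
    point∈ : ∀ n → (img (Mset r s) ∖ InM) (point n)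
    point∈ n = proj₂ (img-Mset r s (φ z₁ r₁ ∘ ι ∘ prog r s) (λ _ → refl)) (point n) (W n , sym (φ∘W≡ n))
             , d∉ℤ ∘ IsInt-cancelˡ (G n) d

  img-Mset-approx : ∀ r s → Finite (img (Mset r s) ∖ InM) → Σ ℕ λ r' → Σ ℤ λ s' → img (Mset r s) ∼ Mset r' s'
  img-Mset-approx r s fin with + r ℤ.+ z₁ in r+z₁≡ | isInt? (φ z₁ r₁ (ι s))
  ... | + r' | yes (s' , c≡s') = r' , s' , img-Mset-∼ r s r' s' (sym r+z₁≡) (sym c≡s')
  ... | + r' | no c∉ℤ = ⊥-elim (img-Mset-nonIntegral r s G G-injective _ c∉ℤ +_ value fin)
    where
    G : ℕ → ℤ
    G n = + (2 ℕ.^ r') ℤ.* + n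
    G-injective : ∀ {m n} → G m ≡ G n → m ≡ n
    G-injective {m} {n} e = ℤP.+-injective (ℤP.*-cancelˡ-≡ (+ (2 ℕ.^ r')) (+ m) (+ n) {{ℕP.m^n≢0 2 r'}} e)
    value : ∀ n → φ z₁ r₁ (ι (prog r s (+ n))) ≡ ι (G n) ℚ.+ φ z₁ r₁ (ι s)
    value n = begin
      φ z₁ r₁ (ι (prog r s (+ n)))                          ≡⟨ φ-prog r s (+ n) ⟩
      pow2 (+ r ℤ.+ z₁) ℚ.* ι (+ n) ℚ.+ φ z₁ r₁ (ι s)       ≡⟨ cong (λ t → pow2 t ℚ.* ι (+ n) ℚ.+ φ z₁ r₁ (ι s)) r+z₁≡ ⟩
      pow2ℕ r' ℚ.* ι (+ n) ℚ.+ φ z₁ r₁ (ι s)                ≡⟨ cong (λ t → t ℚ.* ι (+ n) ℚ.+ φ z₁ r₁ (ι s)) (ι-2^ r') ⟨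
      ι (+ (2 ℕ.^ r')) ℚ.* ι (+ n) ℚ.+ φ z₁ r₁ (ι s)        ≡⟨ cong (ℚ._+ φ z₁ r₁ (ι s)) (ι-* (+ (2 ℕ.^ r')) (+ n)) ⟨
      ι (G n) ℚ.+ φ z₁ r₁ (ι s)                             ∎
      where open ≡-Reasoning
  ... | -[1+ k ] | _ with ∃-nonIntegral-offset k (φ z₁ r₁ (ι s))
  ...   | e , d∉ℤ = ⊥-elim (img-Mset-nonIntegral r s +_ ℤP.+-injective _ d∉ℤ (prog (suc k) e ∘ +_) value fin)
    where
    c : ℚ
    c = φ z₁ r₁ (ι s)
    value : ∀ n → φ z₁ r₁ (ι (prog r s (prog (suc k) e (+ n)))) ≡ ι (+ n) ℚ.+ (powHalf (suc k) ℚ.* ι e ℚ.+ c)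
    value n = begin
      φ z₁ r₁ (ι (prog r s w))                           ≡⟨ φ-prog r s w ⟩
      pow2 (+ r ℤ.+ z₁) ℚ.* ι w ℚ.+ c                    ≡⟨ cong (λ t → pow2 t ℚ.* ι w ℚ.+ c) r+z₁≡ ⟩
      powHalf (suc k) ℚ.* ι w ℚ.+ c                      ≡⟨ cong (ℚ._+ c) (powHalf-prog (suc k) e (+ n)) ⟩
      (ι (+ n) ℚ.+ powHalf (suc k) ℚ.* ι e) ℚ.+ c        ≡⟨ ℚP.+-assoc (ι (+ n)) (powHalf (suc k) ℚ.* ι e) c ⟩
      ι (+ n) ℚ.+ (powHalf (suc k) ℚ.* ι e ℚ.+ c)        ∎
      where
      open ≡-Reasoning
      w : ℤ
      w = prog (suc k) e (+ n)

  img-ℬ-approx : (B : Subset) → Inℬ B → Finite (img B ∖ InM) → Σ ℕ λ r' → Σ ℤ λ s' → img B ∼ Mset r' s'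
  img-ℬ-approx B (r , s , B⇔M) fin =
    map₂ (map₂ (∼-resp-≐ (img-≐ M≐B) ≐-refl))
      (img-Mset-approx r s (Finite-⊆ (λ y (y∈ , y∉M) → img-⊆ (proj₁ M≐B) y y∈ , y∉M) fin))
    where
    M≐B : Mset r s ≐ B
    M≐B = (λ x → proj₂ (B⇔M x)) , (λ x → proj₁ (B⇔M x))

  Approx : ℕ × ℤ → Set
  Approx (r , s) = Σ ℕ λ r' → Σ ℤ λ s' → img (Mset r s) ∼ Mset r' s'

  targets : ∀ {bs} → All Approx bs → List (ℕ × ℤ)
  targets = All.reduce λ { (r' , s' , _) → r' , s' }

  img-⋃M-∼ : ∀ {bs} (approxs : All Approx bs) → img (⋃M bs) ∼ ⋃M (targets approxs)
  img-⋃M-∼ [] = [] , λ { y (inj₁ ((_ , () , _) , _)) ; y (inj₂ (() , _)) }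
  img-⋃M-∼ {b ∷ bs} ((r' , s' , approx) ∷ approxs) =
    ∼-resp-≐ (≐-sym (≐-trans (img-≐ (⋃M-∷ b bs)) img-∪)) (≐-sym (⋃M-∷ (r' , s') (targets approxs)))
      (∼-∪ approx (img-⋃M-∼ approxs))

  img-𝒟 : (D : Subset) → Inᴰ D → img D ⊆ InM → Inᴰ (img D)
  img-𝒟 D (_ , bs , D∼⋃) img⊆M = img⊆M , targets approxs , ∼-trans (img-∼ D∼⋃) (img-⋃M-∼ approxs)
    where
    outside : ∀ {b} → b ∈ bs → (img (Mset (proj₁ b) (proj₂ b)) ∖ InM) ⊆ ((img D ∖ img (⋃M bs)) ∪ (img (⋃M bs) ∖ img D))
    outside b∈bs y (y∈ , y∉M) = inj₂ (img-⊆ (Mset⊆⋃M b∈bs) y y∈ , y∉M ∘ img⊆M y)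
    approxs : All Approx bs
    approxs = All.tabulate λ {b} b∈bs → img-Mset-approx (proj₁ b) (proj₂ b) (Finite-⊆ (outside b∈bs) (img-∼ D∼⋃))

lemma6p4 : (z₁ : ℤ) (r₁ : ℚ)
    → ((r : ℕ) (z : ℤ) (r' : ℕ) (s' : ℤ)
         → + r' ≡ + r ℤ.+ z₁
         → ι s' ≡ pow2 z₁ ℚ.* ι z ℚ.+ r₁
         → φM-img z₁ r₁ (Mset r z) ∼ Mset r' s')
    × ((B : Subset) → Inℬ B
         → Finite (φM-img z₁ r₁ B ∖ InM)
         → Σ ℕ λ r' → Σ ℤ λ s' → φM-img z₁ r₁ B ∼ Mset r' s')
    × ((D : Subset) → Inᴰ D
         → φM-img z₁ r₁ D ⊆ InM
         → Inᴰ (φM-img z₁ r₁ D))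
lemma6p4 z₁ r₁ = img-Mset-∼ z₁ r₁ , img-ℬ-approx z₁ r₁ , img-𝒟 z₁ r₁
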